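{- Let $P$ be an $N$-element poset, let $x\in P$, and let $X=\{y\in P: y<_P x\}$. Suppose that every element of $P$ that is comparable with some element of $X$ is also comparable with $x$. If $L$ and $\widetilde L$ are labelings of $P$ that agree on $P\setminus X$, then for every $\gamma\ge 1$ the labelings $\partial^\gamma(L)$ and $\partial^\gamma(\widetilde L)$ also agree on $P\setminus X$.
   Context: A labeling of an $N$-element poset $P$ is a bijection $L:P\to[N]$. For a labeling $L$ and a non-maximal $x$, the $L$-successor of $x$ is the element $y>_P x$ minimizing $L(y)$. The promotion chain of $L$ is $v_1<_P\cdots<_P v_m$ with $v_1=L^{ -1}(1)$, $v_{i+1}$ the $L$-successor of $v_i$ while $v_i$ is not maximal, and $v_m$ maximal. Extended promotion: $\partial(L)(z)=L(z)-1$ for $z$ not in the chain, $\partial(L)(v_i)=L(v_{i+1})-1$ for $i<m$, $\partial(L)(v_m)=N$. -}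

module Defs where

open import Data.Nat using (ℕ; zero; suc; _∸_; _≤_; _<?_)
open import Data.Fin using (Fin; _≟_)
open import Data.List using (List; []; _∷_; foldr)
open import Data.Bool.ListAction using (any)
open import Data.Maybe using (Maybe; just; nothing)
open import Data.Bool using (Bool; true; false; if_then_else_; _∧_)
open import Data.Product using (Σ; _×_; ∃)
open import Data.Sum using (_⊎_)
open import Data.List using (allFin)
open import Function using (_∘_)
open import Function.Definitions using (Injective)
open import Relation.Binary.PropositionalEquality using (_≡_)
open import Relation.Nullary using (¬_; Dec; yes; no)
open import Relation.Nullary.Decidable using (⌊_⌋)
open import Relation.Binary.Definitions using (Decidable)

record FinPoset (N : ℕ) : Set₁ where
  field
    _<P_     : Fin N → Fin N → Set
    _<P?_    : Decidable _<P_
    irrefl  : ∀ x → ¬ (x <P x)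
    trans   : ∀ {x y z} → x <P y → y <P z → x <P z

open FinPoset public

Comparable : ∀ {N} (P : FinPoset N) → Fin N → Fin N → Set
Comparable P x y = (_<P_ P x y ⊎ _<P_ P y x) ⊎ x ≡ y

IsLabeling : (N : ℕ) → (Fin N → ℕ) → Set
IsLabeling N L =
  Injective _≡_ _≡_ L
  × (∀ z → 1 ≤ L z × L z ≤ N)
  × (∀ k → 1 ≤ k → k ≤ N → ∃ λ z → L z ≡ k)

module _ {N : ℕ} (P : FinPoset N) (L : Fin N → ℕ) where

  successor : Fin N → Maybe (Fin N)
  successor x = foldr step nothing (allFin N)
    where
    better : Fin N → Maybe (Fin N) → Bool
    better y nothing  = true
    better y (just b) = ⌊ L y <? L b ⌋
    step : Fin N → Maybe (Fin N) → Maybe (Fin N)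
    step y best = if ⌊ _<P?_ P x y ⌋ ∧ better y best then just y else best

  minimalLabelled : Maybe (Fin N)
  minimalLabelled = foldr (λ z r → if ⌊ L z Data.Nat.≟ 1 ⌋ then just z else r) nothing (allFin N)

  -- chain v, succ v, succ² v, … (fuel bounds the length; chains in an
  -- N-element poset have at most N elements, so fuel N suffices)
  chainFrom : ℕ → Fin N → List (Fin N)
  chainFrom zero v = v ∷ []
  chainFrom (suc k) v with successor v
  ... | nothing = v ∷ []
  ... | just w  = v ∷ chainFrom k w

  promotionChain : List (Fin N)
  promotionChain with minimalLabelled
  ... | nothing = []
  ... | just v  = chainFrom N v

  inChain : Fin N → Bool
  inChain z = any (λ v → ⌊ v ≟ z ⌋) promotionChain

  ∂ : Fin N → ℕ
  ∂ z with inChain z | successor z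
  ... | false | _       = L z ∸ 1
  ... | true  | just y  = L y ∸ 1
  ... | true  | nothing = N

∂^ : ∀ {N} (P : FinPoset N) → ℕ → (Fin N → ℕ) → (Fin N → ℕ)
∂^ P zero    L = L
∂^ P (suc γ) L = ∂ P (∂^ P γ L)

-- Let X be the set of elements below x. Its complement is an up-set on which L and L̃ agree, so
-- successors, and hence promotion chains, computed by L and L̃ coincide from the moment they enter
-- it. A chain starting in X must leave X, and by the hypothesis every element outside X lying above
-- a point of X lies above x; so it leaves X through the L-least element above x, which is also the
-- L̃-least one. Thus both chains meet the complement of X in the same elements, and ∂L and ∂L̃
-- agree off X. As ∂ maps labelings to labelings, the argument iterates.
module Submission where

open import Defs hiding (trans; irrefl)
open import Data.Nat using (ℕ; zero; suc; _+_; _∸_; _≤_; _<_; _<?_; _≟_; z≤n; s≤s)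
open import Data.Nat.Properties
  using (≤-refl; ≤-trans; ≤-antisym; <⇒≤; <⇒≢; ≮⇒≥; ≤-pred; <-cmp; <-irrefl; ≤∧≢⇒<;
         +-cancelʳ-≡; ∸-cancelʳ-≡; suc-injective)
open import Data.Fin using (Fin; toℕ)
open import Data.Fin.Properties using (toℕ<n; toℕ-injective; injective⇒≤)
open import Data.Bool using (Bool; true; false; if_then_else_; _∧_)
open import Data.Bool.Properties using (T-≡)
open import Data.Maybe using (Maybe; just; nothing; _>>=_)
open import Data.Maybe.Properties using (just-injective)
open import Data.List using (List; []; _∷_; foldr; allFin)
open import Data.List.Properties using (foldr-cong)
open import Data.List.Relation.Unary.Any using (here; there) renaming (map to Any-map)
open import Data.List.Relation.Unary.Any.Properties using (any⁺; any⁻)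
open import Data.List.Membership.Propositional using (_∈_)
open import Data.List.Membership.Propositional.Properties using (∈-allFin)
open import Data.Product using (∃; _×_; _,_; proj₁; proj₂)
open import Data.Sum using (_⊎_; inj₁; inj₂)
open import Function using (_∘_)
open import Function.Bundles using (Equivalence)
open import Function.Definitions using (Injective)
open import Relation.Binary.Definitions using (tri<; tri≈; tri>)
open import Relation.Binary.PropositionalEquality
  using (_≡_; _≢_; refl; sym; trans; cong; subst; subst₂)
open import Relation.Nullary using (¬_; yes; no; contradiction)
open import Relation.Nullary.Decidable using (⌊_⌋; toWitness; fromWitness)
open import Relation.Unary using (Decidable)

module _ {A : Set} (f : A → ℕ) (Q : A → Set) where

  data Least (l : List A) : Maybe A → Set where
    none : (∀ {b} → b ∈ l → ¬ Q b) → Least l nothing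
    some : ∀ {m} → Q m → (∀ {b} → b ∈ l → Q b → f m ≤ f b) → Least l (just m)

module _ {A : Set} (f : A → ℕ) {Q : A → Set} (Q? : Decidable Q) where

  undercuts : A → Maybe A → Bool
  undercuts y nothing  = true
  undercuts y (just b) = ⌊ f y <? f b ⌋

  argminWhere : List A → Maybe A
  argminWhere = foldr (λ y b → if ⌊ Q? y ⌋ ∧ undercuts y b then just y else b) nothing

  argminWhere-least : ∀ l → Least f Q l (argminWhere l)
  argminWhere-least [] = none λ ()
  argminWhere-least (y ∷ l) with Q? y | argminWhere l | argminWhere-least l
  ... | no ¬qy | _ | none ¬q = none λ { (here refl) → ¬qy ; (there b∈l) → ¬q b∈l }
  ... | no ¬qy | _ | some qm min =
    some qm λ { (here refl) qy → contradiction qy ¬qy ; (there b∈l) → min b∈l }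
  ... | yes qy | _ | none ¬q =
    some qy λ { (here refl) _ → ≤-refl ; (there b∈l) qb → contradiction qb (¬q b∈l) }
  ... | yes qy | _ | some {m} qm min with f y <? f m
  ...   | yes y<m = some qy λ { (here refl) _ → ≤-refl
                              ; (there b∈l) qb → ≤-trans (<⇒≤ y<m) (min b∈l qb) }
  ...   | no y≮m  = some qm λ { (here refl) _ → ≮⇒≥ y≮m ; (there b∈l) → min b∈l }

module Orbits {N : ℕ} (P : FinPoset N) (L : Fin N → ℕ) where

  open FinPoset P using () renaming (_<P_ to _⊏_; _<P?_ to _⊏?_; irrefl to ⊏-irrefl; trans to ⊏-trans)

  -- `successor` is this fold, up to the name of its local step function
  successor-least : ∀ v → Least L (v ⊏_) (allFin N) (successor P L v)
  successor-least v =
    subst (Least L (v ⊏_) (allFin N))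
          (foldr-cong (λ { _ nothing → refl ; _ (just _) → refl }) refl (allFin N))
          (argminWhere-least L (v ⊏?_) (allFin N))

  successor-above : ∀ {v w} → successor P L v ≡ just w → v ⊏ w
  successor-above {v} e with successor P L v | successor-least v
  successor-above refl | _ | some v⊏w _ = v⊏w

  successor-minimal : ∀ {v w c} → successor P L v ≡ just w → v ⊏ c → L w ≤ L c
  successor-minimal {v} e with successor P L v | successor-least v
  successor-minimal {c = c} refl | _ | some _ min = min (∈-allFin c)

  successor-maximal : ∀ {v c} → successor P L v ≡ nothing → ¬ v ⊏ c
  successor-maximal {v} e with successor P L v | successor-least v
  successor-maximal {c = c} refl | _ | none ¬above = ¬above (∈-allFin c)

  orbit : ℕ → Fin N → Maybe (Fin N)
  orbit zero    v = just v
  orbit (suc i) v = successor P L v >>= orbit i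

  Reach : Fin N → Fin N → Set
  Reach v z = ∃ λ i → orbit i v ≡ just z

  orbit-+ : ∀ i {j v w} → orbit i v ≡ just w → orbit (i + j) v ≡ orbit j w
  orbit-+ zero refl = refl
  orbit-+ (suc i) {v = v} e with successor P L v
  orbit-+ (suc i) e  | just _ = orbit-+ i e
  orbit-+ (suc i) () | nothing

  Reach-refl : ∀ {v} → Reach v v
  Reach-refl = 0 , refl

  Reach-◅ : ∀ {v w z} → successor P L v ≡ just w → Reach w z → Reach v z
  Reach-◅ s (i , e) = suc i , trans (cong (_>>= orbit i) s) e

  Reach-trans : ∀ {u v w} → Reach u v → Reach v w → Reach u w
  Reach-trans (i , e) (j , e′) = i + j , trans (orbit-+ i e) e′

  Reach-▻ : ∀ {v a b} → Reach v a → successor P L a ≡ just b → Reach v b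
  Reach-▻ r s = Reach-trans r (Reach-◅ s Reach-refl)

  orbit-suc-above : ∀ i {v z} → orbit (suc i) v ≡ just z → v ⊏ z
  orbit-suc-above i {v} e with successor P L v in s
  orbit-suc-above zero    refl | just _ = successor-above s
  orbit-suc-above (suc i) e    | just _ = ⊏-trans (successor-above s) (orbit-suc-above i e)
  orbit-suc-above i       ()   | nothing

  orbit-< : ∀ i j {v a b} → orbit i v ≡ just a → orbit j v ≡ just b → i < j → a ⊏ b
  orbit-< zero    (suc j) refl eb _ = orbit-suc-above j eb
  orbit-< (suc i) (suc j) {v} ea eb (s≤s i<j) with successor P L v
  orbit-< (suc i) (suc j) ea eb (s≤s i<j) | just _ = orbit-< i j ea eb i<j
  orbit-< (suc i) (suc j) () eb (s≤s i<j) | nothing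

  orbit-index-unique : ∀ {i j v a} → orbit i v ≡ just a → orbit j v ≡ just a → i ≡ j
  orbit-index-unique {i} {j} {a = a} ea eb with <-cmp i j
  ... | tri< i<j _ _ = contradiction (orbit-< i j ea eb i<j) (⊏-irrefl a)
  ... | tri≈ _ i≡j _ = i≡j
  ... | tri> _ _ j<i = contradiction (orbit-< j i eb ea j<i) (⊏-irrefl a)

  orbit-defined-below : ∀ i j {v b} → orbit j v ≡ just b → i ≤ j → ∃ λ a → orbit i v ≡ just a
  orbit-defined-below zero    _       {v} _ _ = v , refl
  orbit-defined-below (suc i) (suc j) {v} e (s≤s i≤j) with successor P L v
  orbit-defined-below (suc i) (suc j) e  (s≤s i≤j) | just _ = orbit-defined-below i j e i≤j
  orbit-defined-below (suc i) (suc j) () (s≤s i≤j) | nothing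

  -- the points of a defined orbit segment are pairwise distinct, so there are at most N of them
  orbit-bounded : ∀ {i v a} → orbit i v ≡ just a → i < N
  orbit-bounded {i} {v} e = injective⇒≤ {f = point} point-injective
    where
    point-at : ∀ (k : Fin (suc i)) → ∃ λ a → orbit (toℕ k) v ≡ just a
    point-at k = orbit-defined-below (toℕ k) i e (≤-pred (toℕ<n k))

    point : Fin (suc i) → Fin N
    point k = proj₁ (point-at k)

    point-injective : Injective _≡_ _≡_ point
    point-injective {k} {k′} p≡p′ = toℕ-injective
      (orbit-index-unique (proj₂ (point-at k)) (trans (proj₂ (point-at k′)) (cong just (sym p≡p′))))

  orbit-ends : ∀ v → orbit N v ≡ nothing
  orbit-ends v with orbit N v in e
  ... | nothing = refl
  ... | just _  = contradiction (orbit-bounded e) (<-irrefl refl)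

  reaches-maximal : ∀ v → ∃ λ m → Reach v m × successor P L m ≡ nothing
  reaches-maximal v = maximal-before N (orbit-ends v)
    where
    maximal-before : ∀ n {v} → orbit n v ≡ nothing → ∃ λ m → Reach v m × successor P L m ≡ nothing
    maximal-before zero ()
    maximal-before (suc n) {v} e with successor P L v in s
    ... | nothing = v , Reach-refl , s
    ... | just _  = let m , r , s′ = maximal-before n e in m , Reach-◅ s r , s′

  predecessor : ∀ i {v y} → orbit (suc i) v ≡ just y → ∃ λ a → Reach v a × successor P L a ≡ just y
  predecessor i {v} e with successor P L v in s
  predecessor zero {v} refl | just _ = v , Reach-refl , s
  predecessor (suc i) e | just _ = let a , r , s′ = predecessor i e in a , Reach-◅ s r , s′
  predecessor i () | nothing

  record Crossing (X : Fin N → Set) (v z : Fin N) : Set where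
    field
      inner       : Fin N
      outer       : Fin N
      reach-inner : Reach v inner
      inner∈X     : X inner
      crosses     : successor P L inner ≡ just outer
      outer∉X     : ¬ X outer
      reach-z     : Reach outer z

  crossing : ∀ {X : Fin N → Set} → Decidable X → ∀ {v z} → X v → ¬ X z → Reach v z → Crossing X v z
  crossing {X} X? {z = z} Xv ¬Xz (i , e) = go i Xv e
    where
    go : ∀ i {v} → X v → orbit i v ≡ just z → Crossing X v z
    go zero Xv refl = contradiction Xv ¬Xz
    go (suc i) {v} Xv e with successor P L v in s
    ... | just w with X? w
    ...   | no ¬Xw = record { inner = v ; outer = w ; reach-inner = Reach-refl ; inner∈X = Xv
                            ; crosses = s ; outer∉X = ¬Xw ; reach-z = i , e }
    ...   | yes Xw = let open Crossing (go i Xw e) in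
                     record { inner = inner ; outer = outer ; reach-inner = Reach-◅ s reach-inner
                            ; inner∈X = inner∈X ; crosses = crosses ; outer∉X = outer∉X ; reach-z = reach-z }
    go (suc i) Xv () | nothing

  ∈-chainFrom⁻ : ∀ k {v z} → z ∈ chainFrom P L k v → Reach v z
  ∈-chainFrom⁻ zero (here refl) = Reach-refl
  ∈-chainFrom⁻ (suc k) {v} z∈ with successor P L v in s
  ∈-chainFrom⁻ (suc k) (here refl) | nothing = Reach-refl
  ∈-chainFrom⁻ (suc k) (here refl) | just _  = Reach-refl
  ∈-chainFrom⁻ (suc k) (there z∈)  | just _  = Reach-◅ s (∈-chainFrom⁻ k z∈)

  ∈-chainFrom⁺ : ∀ i k {v z} → orbit i v ≡ just z → i ≤ k → z ∈ chainFrom P L k v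
  ∈-chainFrom⁺ zero zero refl _ = here refl
  ∈-chainFrom⁺ zero (suc k) {v} refl _ with successor P L v
  ... | nothing = here refl
  ... | just _  = here refl
  ∈-chainFrom⁺ (suc i) (suc k) {v} e (s≤s i≤k) with successor P L v
  ... | just _ = there (∈-chainFrom⁺ i k e i≤k)
  ∈-chainFrom⁺ (suc i) (suc k) () _ | nothing

  inChain⇒∈ : ∀ {z} → inChain P L z ≡ true → z ∈ promotionChain P L
  inChain⇒∈ h = Any-map (sym ∘ toWitness) (any⁻ _ _ (Equivalence.from T-≡ h))

  ∈⇒inChain : ∀ {z} → z ∈ promotionChain P L → inChain P L z ≡ true
  ∈⇒inChain z∈ = Equivalence.to T-≡ (any⁺ _ (Any-map (fromWitness ∘ sym) z∈))

  minimalLabelled-≡ : Injective _≡_ _≡_ L → ∀ {v} → L v ≡ 1 → minimalLabelled P L ≡ just v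
  minimalLabelled-≡ inj {v} one = find (allFin N) (∈-allFin v)
    where
    find : ∀ l → v ∈ l → foldr (λ z r → if ⌊ L z ≟ 1 ⌋ then just z else r) nothing l ≡ just v
    find (z ∷ l) v∈ with L z ≟ 1
    ... | yes Lz≡1 = cong just (inj (trans Lz≡1 (sym one)))
    find (z ∷ l) (here refl) | no Lz≢1 = contradiction one Lz≢1
    find (z ∷ l) (there v∈l) | no _    = find l v∈l

  promotionChain-≡ : ∀ {v} → minimalLabelled P L ≡ just v → promotionChain P L ≡ chainFrom P L N v
  promotionChain-≡ e rewrite e = refl

successor-cong : ∀ {N} (P : FinPoset N) {L L′ : Fin N → ℕ} {v} → Injective _≡_ _≡_ L →
                 (∀ c → _<P_ P v c → L c ≡ L′ c) → successor P L v ≡ successor P L′ v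
successor-cong P {L} {L′} {v} inj agree
  with successor P L v | Orbits.successor-least P L v | successor P L′ v | Orbits.successor-least P L′ v
... | _ | none _       | _ | none _        = refl
... | _ | none ¬above  | _ | some v<y′ _   = contradiction v<y′ (¬above (∈-allFin _))
... | _ | some v<y _   | _ | none ¬above′  = contradiction v<y (¬above′ (∈-allFin _))
... | _ | some {y} v<y min | _ | some {y′} v<y′ min′ =
  cong just (inj (≤-antisym (min (∈-allFin y′) v<y′)
    (subst₂ _≤_ (sym (agree y′ v<y′)) (sym (agree y v<y)) (min′ (∈-allFin y) v<y))))

module Promotion {N : ℕ} (P : FinPoset N) {L : Fin N → ℕ} (lab : IsLabeling N L)
                 {v₁ : Fin N} (v₁-one : L v₁ ≡ 1) where

  open FinPoset P using () renaming (_<P_ to _⊏_; irrefl to ⊏-irrefl; trans to ⊏-trans)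
  open Orbits P L

  private
    inj : Injective _≡_ _≡_ L
    inj = proj₁ lab

    range : ∀ z → 1 ≤ L z × L z ≤ N
    range = proj₁ (proj₂ lab)

    surj : ∀ k → 1 ≤ k → k ≤ N → ∃ λ z → L z ≡ k
    surj = proj₂ (proj₂ lab)

  Chain : Fin N → Set
  Chain = Reach v₁

  inChain⇒Chain : ∀ {z} → inChain P L z ≡ true → Chain z
  inChain⇒Chain {z} h =
    ∈-chainFrom⁻ N (subst (z ∈_) (promotionChain-≡ (minimalLabelled-≡ inj v₁-one)) (inChain⇒∈ h))

  Chain⇒inChain : ∀ {z} → Chain z → inChain P L z ≡ true
  Chain⇒inChain {z} (i , e) = ∈⇒inChain
    (subst (z ∈_) (sym (promotionChain-≡ (minimalLabelled-≡ inj v₁-one)))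
           (∈-chainFrom⁺ i N e (<⇒≤ (orbit-bounded e))))

  -- the three clauses of ∂; the value n is an index constrained by an equation, so that two cases
  -- sharing a value can be matched against each other
  data PromotionCase (z : Fin N) (n : ℕ) : Set where
    off  : ¬ Chain z → n ≡ L z ∸ 1 → PromotionCase z n
    next : ∀ {y} → Chain z → successor P L z ≡ just y → n ≡ L y ∸ 1 → PromotionCase z n
    top  : Chain z → successor P L z ≡ nothing → n ≡ N → PromotionCase z n

  inChain≡false⇒¬Chain : ∀ {z} → inChain P L z ≡ false → ¬ Chain z
  inChain≡false⇒¬Chain c ch = contradiction (trans (sym c) (Chain⇒inChain ch)) λ ()

  Chain? : Decidable Chain
  Chain? z with inChain P L z in c
  ... | true  = yes (inChain⇒Chain c)
  ... | false = no (inChain≡false⇒¬Chain c)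

  ∂-case : ∀ z → PromotionCase z (∂ P L z)
  ∂-case z with inChain P L z in c | successor P L z in s
  ... | false | _       = off (inChain≡false⇒¬Chain c) refl
  ... | true  | just _  = next (inChain⇒Chain c) s refl
  ... | true  | nothing = top (inChain⇒Chain c) s refl

  ∂-off : ∀ {z} → ¬ Chain z → ∂ P L z ≡ L z ∸ 1
  ∂-off {z} nc with ∂-case z
  ... | off _ e    = e
  ... | next c _ _ = contradiction c nc
  ... | top c _ _  = contradiction c nc

  ∂-next : ∀ {z y} → Chain z → successor P L z ≡ just y → ∂ P L z ≡ L y ∸ 1
  ∂-next {z} c s with ∂-case z
  ... | off nc _    = contradiction c nc
  ... | next _ s′ e = trans e (cong (λ y → L y ∸ 1) (just-injective (trans (sym s′) s)))
  ... | top _ s′ _  = contradiction (trans (sym s′) s) λ ()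

  ∂-top : ∀ {z} → Chain z → successor P L z ≡ nothing → ∂ P L z ≡ N
  ∂-top {z} c s with ∂-case z
  ... | off nc _    = contradiction c nc
  ... | next _ s′ _ = contradiction (trans (sym s′) s) λ ()
  ... | top _ _ e   = e

  start-least : ∀ {z} → Chain z → v₁ ≡ z ⊎ v₁ ⊏ z
  start-least (zero , refl)  = inj₁ refl
  start-least (suc i , e)    = inj₂ (orbit-suc-above i e)

  successor≢start : ∀ {z y} → Chain z → successor P L z ≡ just y → y ≢ v₁
  successor≢start c s refl with start-least c
  ... | inj₁ refl = ⊏-irrefl _ (successor-above s)
  ... | inj₂ v₁⊏z = ⊏-irrefl _ (⊏-trans v₁⊏z (successor-above s))

  label-pred-range : ∀ {z} → z ≢ v₁ → 1 ≤ L z ∸ 1 × L z ∸ 1 ≤ N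
  label-pred-range {z} z≢v₁ with L z in Lz | range z
  ... | suc (suc _) | _ , Lz≤N = s≤s z≤n , <⇒≤ Lz≤N
  ... | suc zero    | _        = contradiction (inj (trans Lz (sym v₁-one))) z≢v₁

  label-pred<N : ∀ z → L z ∸ 1 < N
  label-pred<N z with L z | range z
  ... | suc _ | _ , Lz≤N = Lz≤N

  label-pred-injective : ∀ {a b} → L a ∸ 1 ≡ L b ∸ 1 → a ≡ b
  label-pred-injective {a} {b} e = inj (∸-cancelʳ-≡ (proj₁ (range a)) (proj₁ (range b)) e)

  case-range : ∀ {z n} → PromotionCase z n → 1 ≤ n × n ≤ N
  case-range     (off nc refl)   = label-pred-range λ { refl → nc Reach-refl }
  case-range     (next c s refl) = label-pred-range (successor≢start c s)
  case-range {z} (top _ _ refl)  = ≤-trans (s≤s z≤n) (toℕ<n z) , ≤-refl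

  off≢next : ∀ {z z′ y} → ¬ Chain z → Chain z′ → successor P L z′ ≡ just y → L z ∸ 1 ≢ L y ∸ 1
  off≢next nc c′ s′ e = nc (subst Chain (sym (label-pred-injective e)) (Reach-▻ c′ s′))

  successor-injective : ∀ {z z′ y} → Chain z → Chain z′ →
                        successor P L z ≡ just y → successor P L z′ ≡ just y → z ≡ z′
  successor-injective (i , e) (j , e′) s s′
    with +-cancelʳ-≡ 1 i j (orbit-index-unique (trans (orbit-+ i e) (proj₂ (Reach-◅ s Reach-refl)))
                                                 (trans (orbit-+ j e′) (proj₂ (Reach-◅ s′ Reach-refl))))
  ... | refl = just-injective (trans (sym e) e′)

  maximal-unique : ∀ {z z′} → Chain z → Chain z′ →
                   successor P L z ≡ nothing → successor P L z′ ≡ nothing → z ≡ z′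
  maximal-unique (i , e) (j , e′) s s′ with <-cmp i j
  ... | tri< i<j _ _  = contradiction (orbit-< i j e e′ i<j) (successor-maximal s)
  ... | tri≈ _ refl _ = just-injective (trans (sym e) e′)
  ... | tri> _ _ j<i  = contradiction (orbit-< j i e′ e j<i) (successor-maximal s′)

  case-injective : ∀ {z z′ n} → PromotionCase z n → PromotionCase z′ n → z ≡ z′
  case-injective (off _ refl)    (off _ e)      = label-pred-injective e
  case-injective (off nc refl)   (next c′ s′ e) = contradiction e (off≢next nc c′ s′)
  case-injective (off _ refl)    (top _ _ e)    = contradiction e (<⇒≢ (label-pred<N _))
  case-injective (next c s refl) (off nc′ e)    = contradiction (sym e) (off≢next nc′ c s)
  case-injective (next c s refl) (next c′ s′ e) =
    successor-injective c c′ s (subst (λ y → successor P L _ ≡ just y) (sym (label-pred-injective e)) s′)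
  case-injective (next _ _ refl) (top _ _ e)    = contradiction e (<⇒≢ (label-pred<N _))
  case-injective (top _ _ refl)  (off _ e)      = contradiction (sym e) (<⇒≢ (label-pred<N _))
  case-injective (top _ _ refl)  (next _ _ e)   = contradiction (sym e) (<⇒≢ (label-pred<N _))
  case-injective (top c s refl)  (top c′ s′ _)  = maximal-unique c c′ s s′

  ∂-surjective : ∀ k → 1 ≤ k → k ≤ N → ∃ λ z → ∂ P L z ≡ k
  ∂-surjective k 1≤k k≤N with k ≟ N
  ... | yes refl = let m , c , s = reaches-maximal v₁ in m , ∂-top c s
  ... | no k≢N with surj (suc k) (s≤s z≤n) (≤∧≢⇒< k≤N k≢N)
  ...   | y , Ly with Chain? y
  ...     | no nc             = y , trans (∂-off nc) (cong (_∸ 1) Ly)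
  ...     | yes (zero , refl) = contradiction (subst (1 ≤_) (suc-injective (trans (sym Ly) v₁-one)) 1≤k) λ ()
  ...     | yes (suc i , e)   = let a , c , s = predecessor i e in a , trans (∂-next c s) (cong (_∸ 1) Ly)

  ∂-isLabeling : IsLabeling N (∂ P L)
  ∂-isLabeling = (λ {z} {z′} e → case-injective (∂-case z) (subst (PromotionCase z′) (sym e) (∂-case z′)))
               , (λ z → case-range (∂-case z))
               , ∂-surjective

labelled-one : ∀ {N} {L : Fin N → ℕ} → IsLabeling N L → Fin N → ∃ λ v → L v ≡ 1
labelled-one (_ , _ , surj) z = surj 1 (s≤s z≤n) (≤-trans (s≤s z≤n) (toℕ<n z))

∂-isLabeling : ∀ {N} (P : FinPoset N) {L : Fin N → ℕ} → IsLabeling N L → IsLabeling N (∂ P L)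
∂-isLabeling {zero}  P lab = (λ { {()} }) , (λ ()) , λ _ 1≤k k≤0 → contradiction (≤-trans 1≤k k≤0) λ ()
∂-isLabeling {suc _} P lab = Promotion.∂-isLabeling P lab (proj₂ (labelled-one lab Fin.zero))

module Agreement {N : ℕ} (P : FinPoset N) (x : Fin N)
  (comparable-below : ∀ y z → _<P_ P z x → Comparable P y z → Comparable P y x)
  {L L′ : Fin N → ℕ} (lab : IsLabeling N L) (lab′ : IsLabeling N L′)
  (agree : ∀ z → ¬ _<P_ P z x → L z ≡ L′ z) where

  open FinPoset P using () renaming (_<P_ to _⊏_; _<P?_ to _⊏?_; irrefl to ⊏-irrefl; trans to ⊏-trans)
  module O  = Orbits P L
  module O′ = Orbits P L′

  X : Fin N → Set
  X z = z ⊏ x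

  X? : Decidable X
  X? z = z ⊏? x

  upward-closed : ∀ {w y} → ¬ X w → w ⊏ y → ¬ X y
  upward-closed ¬Xw w⊏y Xy = ¬Xw (⊏-trans w⊏y Xy)

  successor-agree : ∀ {w} → ¬ X w → successor P L w ≡ successor P L′ w
  successor-agree ¬Xw = successor-cong P (proj₁ lab) λ c w⊏c → agree c (upward-closed ¬Xw w⊏c)

  orbit-agree : ∀ i {v} → ¬ X v → O.orbit i v ≡ O′.orbit i v
  orbit-agree zero    _ = refl
  orbit-agree (suc i) {v} ¬Xv rewrite successor-agree ¬Xv with successor P L′ v in s
  ... | nothing = refl
  ... | just w  = orbit-agree i (upward-closed ¬Xv (O′.successor-above s))

  Reach-agree : ∀ {v z} → ¬ X v → O.Reach v z → O′.Reach v z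
  Reach-agree ¬Xv (i , e) = i , trans (sym (orbit-agree i ¬Xv)) e

  below-every-exit : ∀ {w u w′} → X w → w ⊏ u → ¬ X u → X w′ → w′ ⊏ u
  below-every-exit {w} {u} Xw w⊏u ¬Xu Xw′ with comparable-below u w Xw (inj₁ (inj₂ w⊏u))
  ... | inj₁ (inj₁ u⊏x) = contradiction u⊏x ¬Xu
  ... | inj₁ (inj₂ x⊏u) = ⊏-trans Xw′ x⊏u
  ... | inj₂ refl       = Xw′

  -- both exits are the least element above x, for L and for L′ alike
  exit-unique : ∀ {w u w′ u′} → X w → successor P L w ≡ just u → ¬ X u →
                X w′ → successor P L′ w′ ≡ just u′ → ¬ X u′ → u ≡ u′
  exit-unique {u = u} {u′ = u′} Xw s ¬Xu Xw′ s′ ¬Xu′ = proj₁ lab (≤-antisym Lu≤Lu′ Lu′≤Lu)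
    where
    Lu≤Lu′ : L u ≤ L u′
    Lu≤Lu′ = O.successor-minimal s (below-every-exit Xw′ (O′.successor-above s′) ¬Xu′ Xw)
    Lu′≤Lu : L u′ ≤ L u
    Lu′≤Lu = subst₂ _≤_ (sym (agree u′ ¬Xu′)) (sym (agree u ¬Xu))
                    (O′.successor-minimal s′ (below-every-exit Xw (O.successor-above s) ¬Xu Xw′))

  chain-agree : ∀ {v₁ v₁′ z} → L v₁ ≡ 1 → L′ v₁′ ≡ 1 → ¬ X z → O.Reach v₁ z → O′.Reach v₁′ z
  chain-agree {v₁} {v₁′} {z} one one′ ¬Xz r with X? v₁ | X? v₁′
  ... | no ¬Xv₁ | _ rewrite proj₁ lab′ (trans one′ (trans (sym one) (agree v₁ ¬Xv₁))) = Reach-agree ¬Xv₁ r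
  ... | yes Xv₁ | no ¬Xv₁′ =
    contradiction (subst X (proj₁ lab (trans one (trans (sym one′) (sym (agree v₁′ ¬Xv₁′))))) Xv₁) ¬Xv₁′
  ... | yes Xv₁ | yes Xv₁′ =
    O′.Reach-trans (O′.Reach-▻ C′.reach-inner C′.crosses)
                   (subst (λ u → O′.Reach u z)
                          (exit-unique inner∈X crosses outer∉X C′.inner∈X C′.crosses C′.outer∉X)
                          (Reach-agree outer∉X reach-z))
    where
    maximal′ : ∃ λ m → O′.Reach v₁′ m × successor P L′ m ≡ nothing
    maximal′ = O′.reaches-maximal v₁′
    open O.Crossing (O.crossing X? Xv₁ ¬Xz r)
    module C′ = O′.Crossing (O′.crossing X? Xv₁′ (O′.successor-maximal (proj₂ (proj₂ maximal′)))
                                                 (proj₁ (proj₂ maximal′)))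

∂-agree : ∀ {N} (P : FinPoset N) (x : Fin N)
  → (∀ y z → _<P_ P z x → Comparable P y z → Comparable P y x)
  → ∀ {L L′ : Fin N → ℕ} → IsLabeling N L → IsLabeling N L′
  → (∀ z → ¬ _<P_ P z x → L z ≡ L′ z)
  → ∀ z → ¬ _<P_ P z x → ∂ P L z ≡ ∂ P L′ z
∂-agree P x comparable-below {L} {L′} lab lab′ agree z ¬Xz = by-case (C.∂-case z)
  where
  module A  = Agreement P x comparable-below lab lab′ agree
  module A′ = Agreement P x comparable-below lab′ lab (λ w ¬Xw → sym (agree w ¬Xw))
  module C  = Promotion P lab  (proj₂ (labelled-one lab z))
  module C′ = Promotion P lab′ (proj₂ (labelled-one lab′ z))

  chain⇒chain′ : C.Chain z → C′.Chain z
  chain⇒chain′ = A.chain-agree (proj₂ (labelled-one lab z)) (proj₂ (labelled-one lab′ z)) ¬Xz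

  chain′⇒chain : C′.Chain z → C.Chain z
  chain′⇒chain = A′.chain-agree (proj₂ (labelled-one lab′ z)) (proj₂ (labelled-one lab z)) ¬Xz

  successor′ : ∀ {m} → successor P L z ≡ m → successor P L′ z ≡ m
  successor′ = trans (sym (A.successor-agree ¬Xz))

  by-case : ∀ {n} → C.PromotionCase z n → n ≡ ∂ P L′ z
  by-case (C.off nc refl)   = trans (cong (_∸ 1) (agree z ¬Xz)) (sym (C′.∂-off (nc ∘ chain′⇒chain)))
  by-case (C.next c s refl) =
    trans (cong (_∸ 1) (agree _ (A.upward-closed ¬Xz (Orbits.successor-above P L s))))
          (sym (C′.∂-next (chain⇒chain′ c) (successor′ s)))
  by-case (C.top c s refl)  = sym (C′.∂-top (chain⇒chain′ c) (successor′ s))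

∂^-agree : ∀ {N} (P : FinPoset N) (x : Fin N)
  → (∀ y z → _<P_ P z x → Comparable P y z → Comparable P y x)
  → ∀ {L L′ : Fin N → ℕ} → IsLabeling N L → IsLabeling N L′
  → (∀ z → ¬ _<P_ P z x → L z ≡ L′ z)
  → ∀ γ → IsLabeling N (∂^ P γ L) × IsLabeling N (∂^ P γ L′)
        × (∀ z → ¬ _<P_ P z x → ∂^ P γ L z ≡ ∂^ P γ L′ z)
∂^-agree P x comparable-below lab lab′ agree zero    = lab , lab′ , agree
∂^-agree P x comparable-below lab lab′ agree (suc γ) =
  let labγ , labγ′ , agreeγ = ∂^-agree P x comparable-below lab lab′ agree γ
  in ∂-isLabeling P labγ , ∂-isLabeling P labγ′ , ∂-agree P x comparable-below labγ labγ′ agreeγ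

lemma3p9 : (N : ℕ) (P : FinPoset N) (x : Fin N)
    → (∀ y z → _<P_ P z x → Comparable P y z → Comparable P y x)
    → (L L~ : Fin N → ℕ) → IsLabeling N L → IsLabeling N L~
    → (∀ z → ¬ (_<P_ P z x) → L z ≡ L~ z)
    → ∀ (γ : ℕ) → 1 ≤ γ
    → ∀ z → ¬ (_<P_ P z x) → ∂^ P γ L z ≡ ∂^ P γ L~ z
lemma3p9 N P x comparable-below L L~ lab lab~ agree γ _ =
  proj₂ (proj₂ (∂^-agree P x comparable-below lab lab~ agree γ))
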